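{- Let $k\ge 0$ and $n\ge 3k+1$ be integers, and let $w$ be a composition of $n$ having more than $k$ entries equal to $1$. Then $w$ is uniquely determined by its set of $k$-deletions: if $w'$ is any composition whose set of $k$-deletions equals that of $w$, then $w'=w$.
   Context: A composition is a finite word $w=w(1)w(2)\cdots w(m)$ whose letters are positive integers; it is a composition of $n$ if $w(1)+\cdots+w(m)=n$. A $1$-deletion of $w$ is a composition obtained from $w$ either by lowering an entry that is $\ge 2$ by $1$, or by removing an entry equal to $1$. For $k\ge 0$, the $k$-deletions of $w$ are defined recursively: the only $0$-deletion of $w$ is $w$ itself, and a $k$-deletion is a $1$-deletion of a $(k-1)$-deletion. -}

module Defs where

open import Data.Nat using (ℕ; zero; suc; _≤_)
open import Data.List using (List; []; _∷_; length; filter)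
open import Data.List.Relation.Unary.All using (All)
open import Data.Nat using (_≟_)

IsComposition : List ℕ → Set
IsComposition w = All (λ x → 1 ≤ x) w

ones : List ℕ → ℕ
ones w = length (filter (_≟ 1) w)

data Del1 : List ℕ → List ℕ → Set where
  lower  : ∀ {a} (xs : List ℕ) → Del1 (suc (suc a) ∷ xs) (suc a ∷ xs)
  remove : (xs : List ℕ) → Del1 (1 ∷ xs) xs
  there  : ∀ x {xs ys} → Del1 xs ys → Del1 (x ∷ xs) (x ∷ ys)

data DelK : ℕ → List ℕ → List ℕ → Set where
  done : ∀ {w} → DelK zero w w
  step : ∀ {k w v u} → DelK k w v → Del1 v u → DelK (suc k) w u

-- For compositions, the k-deletions of x are exactly the compositions u that embed into x
-- as an entrywise dominated subsequence (u ⊑ x) with sum u + k = sum x.  Removing k ones from w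
-- is a k-deletion, and a counting argument using n ≥ 3k + 1 shows that w' has at least k ones
-- as well; comparing these deletions, w and w' have the same sum, the same length and the same
-- subsequence of entries ≥ 2.  If w ≠ w', then at the first difference one word has a 1 and the
-- other an entry c ≥ 2, right after a run of a ones.  With E the common excess sum − length,
-- one of the words has a k-deletion that the other lacks: a lowering of full length keeping c ≥ 2
-- (k < E), the word 1…1 2 1…1 (E ≤ k < E + a), or the word with k ones removed away from that run
-- (E + a ≤ k): an embedding into a word with equally many entries ≥ 2 must match these entries,
-- so its run of a + 1 ones would have to fit into the corresponding run of a ones.
module Submission where

open import Defs
open import Data.Nat using (ℕ; _≤_; _<_; _+_; _*_)
open import Data.List using (List)
open import Data.Nat.ListAction using (sum)
open import Data.Product using (_×_)
open import Relation.Binary.PropositionalEquality using (_≡_)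

open import Data.Nat using (zero; suc; z≤n; s≤s; _∸_; _≤?_; _<?_)
open import Data.Nat.Properties
open import Data.Nat.Tactic.RingSolver using (solve-∀)
open import Data.List using ([]; _∷_; _++_; [_]; length; replicate; filter)
open import Data.List.Properties
  using (length-++; length-++-≤ʳ; length-replicate; ++-assoc; filter-++; ∷-injective)
open import Data.List.Relation.Unary.All using (All; []; _∷_)
import Data.List.Relation.Unary.All.Properties as All
open import Data.List.Relation.Binary.Pointwise as Pointwise
  using (Pointwise; []; _∷_; Pointwise-length; Pointwise-≡⇒≡)
open import Data.List.Relation.Binary.Sublist.Heterogeneous using (Sublist; []; _∷_; _∷ʳ_; minimum)
import Data.List.Relation.Binary.Sublist.Heterogeneous.Properties as Sublist
open import Data.Product using (∃-syntax; _,_; proj₁; proj₂)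
open import Data.Sum using (_⊎_; inj₁; inj₂)
import Data.Sum as Sum
open import Data.Empty using (⊥; ⊥-elim)
open import Function using (_∘_)
open import Relation.Nullary using (Dec; yes; no)
open import Relation.Unary using (_⊆_)
open import Relation.Binary.PropositionalEquality
  using (refl; sym; trans; cong; cong₂; subst; subst₂; module ≡-Reasoning)

infix 4 _⊑_
_⊑_ : List ℕ → List ℕ → Set
_⊑_ = Sublist _≤_

open Sublist.Reflexivity {R = _≤_} ≤-refl using () renaming (refl to ⊑-refl)
open Sublist.Transitivity {R = _≤_} {S = _≤_} {T = _≤_} ≤-trans using () renaming (trans to ⊑-trans)
open Sublist.Antisymmetry {R = _≤_} {S = _≤_} {E = _≡_} ≤-antisym using () renaming (antisym to ⊑-antisym)

-- Deletions as dominated subsequences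

Del1⇒⊑ : ∀ {v u} → Del1 v u → u ⊑ v
Del1⇒⊑ (lower xs)  = n≤1+n _ ∷ ⊑-refl
Del1⇒⊑ (remove xs) = 1 ∷ʳ ⊑-refl
Del1⇒⊑ (there x d) = ≤-refl ∷ Del1⇒⊑ d

DelK⇒⊑ : ∀ {k w u} → DelK k w u → u ⊑ w
DelK⇒⊑ done       = ⊑-refl
DelK⇒⊑ (step d s) = ⊑-trans (Del1⇒⊑ s) (DelK⇒⊑ d)

Del1-sum : ∀ {v u} → Del1 v u → suc (sum u) ≡ sum v
Del1-sum (lower xs)  = refl
Del1-sum (remove xs) = refl
Del1-sum (there x d) = trans (sym (+-suc x _)) (cong (x +_) (Del1-sum d))

DelK-sum : ∀ {k w u} → DelK k w u → sum u + k ≡ sum w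
DelK-sum done = +-identityʳ _
DelK-sum {suc k} {w} {u} (step {v = v} d s) = begin
  sum u + suc k   ≡⟨ +-suc (sum u) k ⟩
  suc (sum u) + k ≡⟨ cong (_+ k) (Del1-sum s) ⟩
  sum v + k       ≡⟨ DelK-sum d ⟩
  sum w           ∎
  where open ≡-Reasoning

Del1-length : ∀ {v u} → Del1 v u → length v ≤ suc (length u)
Del1-length (lower xs)  = n≤1+n _
Del1-length (remove xs) = ≤-refl
Del1-length (there x d) = s≤s (Del1-length d)

DelK-length : ∀ {k w u} → DelK k w u → length w ≤ length u + k
DelK-length {w = w} done = m≤m+n (length w) 0
DelK-length {suc k} {w} {u} (step {v = v} d s) = begin
  length w           ≤⟨ DelK-length d ⟩
  length v + k       ≤⟨ +-monoˡ-≤ k (Del1-length s) ⟩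
  suc (length u) + k ≡⟨ +-suc (length u) k ⟨
  length u + suc k   ∎
  where open ≤-Reasoning

Del1-composition : ∀ {v u} → IsComposition v → Del1 v u → IsComposition u
Del1-composition (_ ∷ cv)  (lower xs)  = s≤s z≤n ∷ cv
Del1-composition (_ ∷ cv)  (remove xs) = cv
Del1-composition (p ∷ cv)  (there x d) = p ∷ Del1-composition cv d

DelK-composition : ∀ {k w u} → IsComposition w → DelK k w u → IsComposition u
DelK-composition cw done       = cw
DelK-composition cw (step d s) = Del1-composition (DelK-composition cw d) s

DelK-trans : ∀ {a b x y z} → DelK a x y → DelK b y z → DelK (a + b) x z
DelK-trans {a} d done rewrite +-identityʳ a = d
DelK-trans {a} d (step {b} e s) rewrite +-suc a b = step (DelK-trans d e) s

DelK-∷ : ∀ {k xs ys} x → DelK k xs ys → DelK k (x ∷ xs) (x ∷ ys)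
DelK-∷ x done       = done
DelK-∷ x (step d s) = step (DelK-∷ x d) (there x s)

DelK-++ˡ : ∀ {k xs ys} ps → DelK k xs ys → DelK k (ps ++ xs) (ps ++ ys)
DelK-++ˡ []       d = d
DelK-++ˡ (p ∷ ps) d = DelK-∷ p (DelK-++ˡ ps d)

Del1-++ʳ : ∀ {xs ys} zs → Del1 xs ys → Del1 (xs ++ zs) (ys ++ zs)
Del1-++ʳ zs (lower xs)  = lower (xs ++ zs)
Del1-++ʳ zs (remove xs) = remove (xs ++ zs)
Del1-++ʳ zs (there x d) = there x (Del1-++ʳ zs d)

DelK-++ʳ : ∀ {k xs ys} zs → DelK k xs ys → DelK k (xs ++ zs) (ys ++ zs)
DelK-++ʳ zs done       = done
DelK-++ʳ zs (step d s) = step (DelK-++ʳ zs d) (Del1-++ʳ zs s)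

DelK-lowerHead : ∀ d b xs → DelK d (suc b + d ∷ xs) (suc b ∷ xs)
DelK-lowerHead zero    b xs rewrite +-identityʳ b = done
DelK-lowerHead (suc d) b xs rewrite +-suc b d = step (DelK-lowerHead d (suc b) xs) (lower xs)

DelK-dropHead : ∀ b xs → DelK (suc b) (suc b ∷ xs) xs
DelK-dropHead b xs = step (DelK-lowerHead b 0 xs) (remove xs)

⊑⇒∃DelK : ∀ {u x} → IsComposition u → IsComposition x → u ⊑ x → ∃[ k ] DelK k x u
⊑⇒∃DelK [] [] [] = 0 , done
⊑⇒∃DelK cu (s≤s {n = b} z≤n ∷ cx) (_ ∷ʳ u⊑x) =
  let k , d = ⊑⇒∃DelK cu cx u⊑x in suc b + k , DelK-trans (DelK-dropHead b _) d
⊑⇒∃DelK (s≤s {n = c} z≤n ∷ cu) (_ ∷ cx) (c<y ∷ u⊑x) with m≤n⇒∃[o]m+o≡n c<y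
... | d , refl =
  let k , del = ⊑⇒∃DelK cu cx u⊑x in d + k , DelK-trans (DelK-lowerHead d c _) (DelK-∷ _ del)

⊑⇒DelK : ∀ {u x k} → IsComposition u → IsComposition x → u ⊑ x → sum u + k ≡ sum x → DelK k x u
⊑⇒DelK {u} cu cx u⊑x eq =
  let _ , d = ⊑⇒∃DelK cu cx u⊑x
  in subst (λ j → DelK j _ u) (+-cancelˡ-≡ (sum u) _ _ (trans (DelK-sum d) (sym eq))) d

bigs : List ℕ → List ℕ
bigs = filter (2 ≤?_)

bigs-++ : ∀ xs ys → bigs (xs ++ ys) ≡ bigs xs ++ bigs ys
bigs-++ = filter-++ (2 ≤?_)

bigs-⊑ : ∀ {u x} → u ⊑ x → bigs u ⊑ bigs x
bigs-⊑ = Sublist.⊆-filter-Sublist (2 ≤?_) (2 ≤?_) (λ u≤x 2≤u → ≤-trans 2≤u u≤x)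

⊑⇒bigs-length-≢suc : ∀ {u x} → u ⊑ x → length (bigs u) ≡ suc (length (bigs x)) → ⊥
⊑⇒bigs-length-≢suc u⊑x eq = 1+n≰n (subst (_≤ _) eq (Sublist.length-mono-≤ (bigs-⊑ u⊑x)))

ones-++ : ∀ xs ys → ones (xs ++ ys) ≡ ones xs + ones ys
ones-++ xs ys = trans (cong length (filter-++ _ xs ys)) (length-++ (filter _ xs))

ones-∷ : ∀ x xs → ones xs ≤ ones (x ∷ xs)
ones-∷ zero          xs = ≤-refl
ones-∷ (suc zero)    xs = n≤1+n _
ones-∷ (suc (suc b)) xs = ≤-refl

sum-replicate-1 : ∀ n → sum (replicate n 1) ≡ n
sum-replicate-1 zero    = refl
sum-replicate-1 (suc n) = cong suc (sum-replicate-1 n)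

ones-replicate-1 : ∀ n → ones (replicate n 1) ≡ n
ones-replicate-1 zero    = refl
ones-replicate-1 (suc n) = cong suc (ones-replicate-1 n)

replicate-1-composition : ∀ n → IsComposition (replicate n 1)
replicate-1-composition n = All.replicate⁺ n ≤-refl

replicate-1-≤ : ∀ {x} → IsComposition x → Pointwise _≤_ (replicate (length x) 1) x
replicate-1-≤ []         = []
replicate-1-≤ (1≤y ∷ cx) = 1≤y ∷ replicate-1-≤ cx

replicate-1-⊑ : ∀ {n x} → IsComposition x → n ≤ length x → replicate n 1 ⊑ x
replicate-1-⊑ {zero}  {x} _          _          = minimum x
replicate-1-⊑ {suc n}     (1≤y ∷ cx) (s≤s n≤x) = 1≤y ∷ replicate-1-⊑ cx n≤x

length≤sum : ∀ {x} → IsComposition x → length x ≤ sum x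
length≤sum []         = z≤n
length≤sum (1≤y ∷ cx) = +-mono-≤ 1≤y (length≤sum cx)

excess : List ℕ → ℕ
excess x = sum x ∸ length x

length+excess : ∀ {x} → IsComposition x → length x + excess x ≡ sum x
length+excess cx = m+[n∸m]≡n (length≤sum cx)

removeOnes : ℕ → List ℕ → List ℕ
removeOnes zero    xs              = xs
removeOnes (suc j) []              = []
removeOnes (suc j) (suc zero ∷ xs) = removeOnes j xs
removeOnes (suc j) (x ∷ xs)        = x ∷ removeOnes (suc j) xs

removeOnes-DelK : ∀ j xs → j ≤ ones xs → DelK j xs (removeOnes j xs)
removeOnes-DelK zero    xs                 _            = done
removeOnes-DelK (suc j) (zero ∷ xs)        j<ones       = DelK-∷ _ (removeOnes-DelK (suc j) xs j<ones)
removeOnes-DelK (suc j) (suc zero ∷ xs)    (s≤s j≤ones) =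
  DelK-trans (DelK-dropHead 0 xs) (removeOnes-DelK j xs j≤ones)
removeOnes-DelK (suc j) (suc (suc b) ∷ xs) j<ones       = DelK-∷ _ (removeOnes-DelK (suc j) xs j<ones)

length-removeOnes : ∀ j xs → j ≤ ones xs → length (removeOnes j xs) + j ≡ length xs
length-removeOnes zero    xs                 _            = +-identityʳ (length xs)
length-removeOnes (suc j) (zero ∷ xs)        j<ones       = cong suc (length-removeOnes (suc j) xs j<ones)
length-removeOnes (suc j) (suc zero ∷ xs)    (s≤s j≤ones) =
  trans (+-suc _ j) (cong suc (length-removeOnes j xs j≤ones))
length-removeOnes (suc j) (suc (suc b) ∷ xs) j<ones       = cong suc (length-removeOnes (suc j) xs j<ones)

bigs-removeOnes : ∀ j xs → bigs (removeOnes j xs) ≡ bigs xs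
bigs-removeOnes zero    xs                 = refl
bigs-removeOnes (suc j) []                 = refl
bigs-removeOnes (suc j) (zero ∷ xs)        = bigs-removeOnes (suc j) xs
bigs-removeOnes (suc j) (suc zero ∷ xs)    = bigs-removeOnes j xs
bigs-removeOnes (suc j) (suc (suc b) ∷ xs) = cong (suc (suc b) ∷_) (bigs-removeOnes (suc j) xs)

module _ {k x y} (k≤ones : k ≤ ones x) (x⊆y : DelK k x ⊆ DelK k y) where

  private
    thinned : DelK k x (removeOnes k x)
    thinned = removeOnes-DelK k x k≤ones

  ⊆⇒sum-≡ : sum y ≡ sum x
  ⊆⇒sum-≡ = trans (sym (DelK-sum (x⊆y thinned))) (DelK-sum thinned)

  ⊆⇒length-≤ : length y ≤ length x
  ⊆⇒length-≤ = subst (length y ≤_) (length-removeOnes k x k≤ones) (DelK-length (x⊆y thinned))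

  ⊆⇒bigs-⊑ : bigs x ⊑ bigs y
  ⊆⇒bigs-⊑ = subst (_⊑ bigs y) (bigs-removeOnes k x) (bigs-⊑ (DelK⇒⊑ (x⊆y thinned)))

counting-step : ∀ {s L S O l} → s + 2 * L ≤ S + O + 2 * l → ∀ p q o t → p + 2 ≤ q + o + 2 * t →
                p + s + 2 * suc L ≤ q + S + (o + O) + 2 * (t + l)
counting-step {s} {L} {S} {O} {l} ih p q o t cost = begin
  p + s + 2 * suc L                 ≡⟨ lhs p s L ⟩
  (p + 2) + (s + 2 * L)             ≤⟨ +-mono-≤ cost ih ⟩
  (q + o + 2 * t) + (S + O + 2 * l) ≡⟨ rhs q o t S O l ⟩
  q + S + (o + O) + 2 * (t + l)     ∎
  where
  open ≤-Reasoning
  lhs : ∀ p s L → p + s + 2 * suc L ≡ (p + 2) + (s + 2 * L)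
  lhs = solve-∀
  rhs : ∀ q o t S O l → (q + o + 2 * t) + (S + O + 2 * l) ≡ q + S + (o + O) + 2 * (t + l)
  rhs = solve-∀

-- An entry of x that u skips costs at least 2 units of sum, or 1 if it is a 1.
counting : ∀ {u x} → IsComposition x → u ⊑ x →
           sum u + 2 * length x ≤ sum x + ones x + 2 * length u
counting [] [] = ≤-refl
counting {u} {suc zero ∷ ys} (_ ∷ cx) (_ ∷ʳ u⊑x) =
  counting-step {sum u} {length ys} {sum ys} {ones ys} {length u} (counting cx u⊑x)
    0 1 1 0 ≤-refl
counting {u} {suc (suc b) ∷ ys} (_ ∷ cx) (_ ∷ʳ u⊑x) =
  counting-step {sum u} {length ys} {sum ys} {ones ys} {length u} (counting cx u⊑x)
    0 (suc (suc b)) 0 0 (s≤s (s≤s z≤n))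
counting {u₀ ∷ us} {y ∷ ys} (_ ∷ cx) (u₀≤y ∷ u⊑x) = ≤-trans
  (counting-step (counting cx u⊑x) u₀ y 0 1 (+-monoˡ-≤ 2 (≤-trans u₀≤y (m≤m+n y 0))))
  (+-monoˡ-≤ _ (+-monoʳ-≤ (y + sum ys) (ones-∷ y ys)))

counting-[] : ∀ {x} → IsComposition x → 2 * length x ≤ sum x + ones x
counting-[] {x} cx = subst (2 * length x ≤_) (+-identityʳ _) (counting cx (minimum x))

short-deletion-arith : ∀ s k L l o → s + 2 * L ≤ s + k + o + 2 * l → l + k ≤ L → k ≤ o
short-deletion-arith s k L l o counted short = +-cancelˡ-≤ (s + 2 * l + k) k o (begin
  s + 2 * l + k + k ≡⟨ lhs s l k ⟩
  s + 2 * (l + k)   ≤⟨ +-monoʳ-≤ s (*-monoʳ-≤ 2 short) ⟩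
  s + 2 * L         ≤⟨ counted ⟩
  s + k + o + 2 * l ≡⟨ rhs s k o l ⟩
  s + 2 * l + k + o ∎)
  where
  open ≤-Reasoning
  lhs : ∀ s l k → s + 2 * l + k + k ≡ s + 2 * (l + k)
  lhs = solve-∀
  rhs : ∀ s k o l → s + k + o + 2 * l ≡ s + 2 * l + k + o
  rhs = solve-∀

DelK-short⇒ones : ∀ {k y u} → IsComposition y → DelK k y u → length u + k ≤ length y → k ≤ ones y
DelK-short⇒ones {k} {y} {u} cy d =
  short-deletion-arith (sum u) k (length y) (length u) (ones y)
    (subst (λ s → sum u + 2 * length y ≤ s + ones y + 2 * length u) (sym (DelK-sum d))
       (counting cy (DelK⇒⊑ d)))

lower-once : ∀ {lo z} → Pointwise _≤_ lo z → sum lo < sum z →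
             ∃[ u ] Pointwise _≤_ lo u × Pointwise _≤_ u z × suc (sum u) ≡ sum z
lower-once {l ∷ lo} {x ∷ z} (l≤x ∷ lo≤z) lo<z with m≤n⇒m<n∨m≡n l≤x
... | inj₁ (s≤s {n = x′} l≤x′) = x′ ∷ z , l≤x′ ∷ lo≤z , n≤1+n x′ ∷ Pointwise.refl ≤-refl , refl
... | inj₂ refl =
  let u , lo≤u , u≤z , su = lower-once lo≤z (+-cancelˡ-< l _ _ lo<z)
  in l ∷ u , ≤-refl ∷ lo≤u , ≤-refl ∷ u≤z , trans (sym (+-suc l (sum u))) (cong (l +_) su)

lower-by : ∀ k {lo z} → Pointwise _≤_ lo z → k + sum lo ≤ sum z →
           ∃[ u ] Pointwise _≤_ lo u × Pointwise _≤_ u z × sum u + k ≡ sum z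
lower-by zero    {z = z} lo≤z _ = z , lo≤z , Pointwise.refl ≤-refl , +-identityʳ (sum z)
lower-by (suc k) {lo} lo≤z room =
  let v , lo≤v , v≤z , sv = lower-once lo≤z (≤-trans (s≤s (m≤n+m (sum lo) k)) room)
      u , lo≤u , u≤v , su = lower-by k lo≤v (≤-pred (subst (suc (k + sum lo) ≤_) (sym sv) room))
  in u , lo≤u , Pointwise.transitive ≤-trans u≤v v≤z , trans (+-suc (sum u) k) (trans (cong suc su) sv)

lowering-DelK : ∀ {k lo x} → IsComposition lo → IsComposition x → Pointwise _≤_ lo x →
                k + sum lo ≤ sum x → ∃[ u ] Pointwise _≤_ lo u × Pointwise _≤_ u x × DelK k x u
lowering-DelK {k} clo cx lo≤x room =
  let u , lo≤u , u≤x , su = lower-by k lo≤x room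
      cu = Pointwise.All-resp-Pointwise (λ l≤u 1≤l → ≤-trans 1≤l l≤u) lo≤u clo
  in u , lo≤u , u≤x , ⊑⇒DelK cu cx (Sublist.fromPointwise u≤x) su

-- A lower bound on the number of ones

ones-bound-arith₁ : ∀ m E e → 3 * (E + e) + 1 ≤ m + E → e ≤ m
ones-bound-arith₁ m E e 3k<n = +-cancelʳ-≤ E e m (begin
  e + E                     ≤⟨ m≤m+n (e + E) (2 * (E + e) + 1) ⟩
  e + E + (2 * (E + e) + 1) ≡⟨ eq E e ⟩
  3 * (E + e) + 1           ≤⟨ 3k<n ⟩
  m + E                     ∎)
  where
  open ≤-Reasoning
  eq : ∀ E e → e + E + (2 * (E + e) + 1) ≡ 3 * (E + e) + 1
  eq = solve-∀

ones-bound-arith₂ : ∀ f e E L o → f ≤ L → 2 * L ≤ e + f + E + o → 3 * (E + e) + 1 ≤ e + f + E →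
                    E + e ≤ o
ones-bound-arith₂ f e E L o f≤L counted 3k<n =
  ≤-trans (m≤m+n (E + e) 1) (+-cancelˡ-≤ (2 * (E + e)) _ _ (begin
    2 * (E + e) + (E + e + 1) ≡⟨ lhs E e ⟩
    3 * (E + e) + 1           ≤⟨ 3k<n ⟩
    e + f + E                 ≤⟨ +-monoˡ-≤ E (+-monoʳ-≤ e f≤eEo) ⟩
    e + (e + E + o) + E       ≡⟨ rhs E e o ⟩
    2 * (E + e) + o           ∎))
  where
  open ≤-Reasoning
  lhs : ∀ E e → 2 * (E + e) + (E + e + 1) ≡ 3 * (E + e) + 1
  lhs = solve-∀
  rhs : ∀ E e o → e + (e + E + o) + E ≡ 2 * (E + e) + o
  rhs = solve-∀
  shuffle : ∀ e f E o → e + f + E + o ≡ f + (e + E + o)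
  shuffle = solve-∀
  f≤eEo : f ≤ e + E + o
  f≤eEo = +-cancelˡ-≤ f f (e + E + o) (begin
    f + f           ≡⟨ cong (f +_) (+-identityʳ f) ⟨
    2 * f           ≤⟨ *-monoʳ-≤ 2 f≤L ⟩
    2 * L           ≤⟨ counted ⟩
    e + f + E + o   ≡⟨ shuffle e f E o ⟩
    f + (e + E + o) ∎)

-- y is at least as long as x, since x can be lowered by k without being shortened.
ones-bound-excess≥k : ∀ {k x y} → IsComposition x → IsComposition y → k ≤ ones x → k ≤ excess x →
                      DelK k x ⊆ DelK k y → k ≤ ones y
ones-bound-excess≥k {k} {x} {y} cx cy k≤ones k≤E x⊆y
  with lowering-DelK (replicate-1-composition (length x)) cx (replicate-1-≤ cx) room
  where
  room : k + sum (replicate (length x) 1) ≤ sum x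
  room = subst₂ _≤_ (cong (k +_) (sym (sum-replicate-1 _)))
           (trans (+-comm (excess x) (length x)) (length+excess cx)) (+-monoˡ-≤ (length x) k≤E)
... | u , _ , u≤x , u∈x = DelK-short⇒ones cy (x⊆y (removeOnes-DelK k x k≤ones)) (begin
  length (removeOnes k x) + k ≡⟨ length-removeOnes k x k≤ones ⟩
  length x                    ≡⟨ Pointwise-length u≤x ⟨
  length u                    ≤⟨ Sublist.length-mono-≤ (DelK⇒⊑ (x⊆y u∈x)) ⟩
  length y                    ∎)
  where open ≤-Reasoning

-- The k-deletion of x consisting of ones only makes y long, and a long composition of a given
-- sum has many ones.
ones-bound-excess≤k : ∀ {k x y} → IsComposition x → IsComposition y → 3 * k + 1 ≤ sum x →
                      excess x ≤ k → sum y ≡ sum x → DelK k x ⊆ DelK k y → k ≤ ones y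
ones-bound-excess≤k {k} {x} {y} cx cy 3k<n E≤k sum≡ x⊆y with m≤n⇒∃[o]m+o≡n E≤k
... | e , refl with m≤n⇒∃[o]m+o≡n (ones-bound-arith₁ (length x) (excess x) e
                                     (subst (3 * (excess x + e) + 1 ≤_) (sym (length+excess cx)) 3k<n))
... | f , e+f≡m =
  ones-bound-arith₂ f e E (length y) (ones y) f≤y counted (subst (3 * (E + e) + 1 ≤_) n≡ 3k<n)
  where
  E = excess x
  n≡ : sum x ≡ e + f + E
  n≡ = trans (sym (length+excess cx)) (cong (_+ E) (sym e+f≡m))
  shuffle : ∀ f E e → f + (E + e) ≡ e + f + E
  shuffle = solve-∀
  ones-only : DelK (E + e) x (replicate f 1)
  ones-only = ⊑⇒DelK (replicate-1-composition f) cx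
    (replicate-1-⊑ cx (subst (f ≤_) e+f≡m (m≤n+m f e)))
    (trans (cong (_+ (E + e)) (sum-replicate-1 f)) (trans (shuffle f E e) (sym n≡)))
  f≤y : f ≤ length y
  f≤y = subst (_≤ length y) (length-replicate f) (Sublist.length-mono-≤ (DelK⇒⊑ (x⊆y ones-only)))
  counted : 2 * length y ≤ e + f + E + ones y
  counted = subst (λ s → 2 * length y ≤ s + ones y) (trans sum≡ n≡) (counting-[] cy)

ones-bound : ∀ {k x y} → IsComposition x → IsComposition y → 3 * k + 1 ≤ sum x → k ≤ ones x →
             DelK k x ⊆ DelK k y → k ≤ ones y
ones-bound {k} {x} cx cy 3k<n k≤ones x⊆y with k ≤? excess x
... | yes k≤E = ones-bound-excess≥k cx cy k≤ones k≤E x⊆y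
... | no  k≰E = ones-bound-excess≤k cx cy 3k<n (<⇒≤ (≰⇒> k≰E)) (⊆⇒sum-≡ k≤ones x⊆y) x⊆y

⊑-++-cancelˡ : ∀ {U₁ U₂ X} P → (U₁ ++ U₂) ⊑ (P ++ X) → length P ≤ length U₁ → U₂ ⊑ X
⊑-++-cancelˡ {[]}     [] s _ = s
⊑-++-cancelˡ {_ ∷ U₁} [] s _ = ⊑-++-cancelˡ {U₁} [] (Sublist.∷ˡ⁻ s) z≤n
⊑-++-cancelˡ {_ ∷ U₁} (_ ∷ P) (_ ∷ʳ s) (s≤s P≤U) = ⊑-++-cancelˡ {_ ∷ U₁} P s (m≤n⇒m≤1+n P≤U)
⊑-++-cancelˡ {_ ∷ U₁} (_ ∷ P) (_ ∷ s)  (s≤s P≤U) = ⊑-++-cancelˡ {U₁} P s P≤U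

++-∷-⋢ : ∀ {b V Q} U → (U ++ b ∷ V) ⊑ Q → length Q ≤ length V → ⊥
++-∷-⋢ {b} {V} U s Q≤V =
  1+n≰n (≤-trans (length-++-≤ʳ (b ∷ V) {U}) (≤-trans (Sublist.length-mono-≤ s) Q≤V))

⊑-window : ∀ {t b V w Q} U W → (U ++ b ∷ V) ⊑ (W ++ w ∷ Q) → All (_≤ t) W → w ≤ t →
           length Q ≤ length V → b ≤ t
⊑-window []      []      (b≤w ∷ _)  _         w≤t _   = ≤-trans b≤w w≤t
⊑-window []      []      (_ ∷ʳ s)   _         _   Q≤V = ⊥-elim (++-∷-⋢ [] s Q≤V)
⊑-window (_ ∷ U) []      (_ ∷ʳ s)   _         _   Q≤V = ⊥-elim (++-∷-⋢ (_ ∷ U) s Q≤V)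
⊑-window (_ ∷ U) []      (_ ∷ s)    _         _   Q≤V = ⊥-elim (++-∷-⋢ U s Q≤V)
⊑-window U       (_ ∷ W) (_ ∷ʳ s)   (_ ∷ W≤t) w≤t Q≤V = ⊑-window U W s W≤t w≤t Q≤V
⊑-window []      (_ ∷ W) (b≤w ∷ _)  (w≤t ∷ _) _   _   = ≤-trans b≤w w≤t
⊑-window (_ ∷ U) (_ ∷ W) (_ ∷ s)    (_ ∷ W≤t) w≤t Q≤V = ⊑-window U W s W≤t w≤t Q≤V

spike : ℕ → ℕ → List ℕ
spike g j = replicate g 1 ++ 2 ∷ replicate j 1

sum-spike : ∀ i g j → sum (replicate i 1 ++ spike g j) ≡ i + (g + (2 + j))
sum-spike (suc i) g       j = cong suc (sum-spike i g j)
sum-spike zero    (suc g) j = cong suc (sum-spike 0 g j)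
sum-spike zero    zero    j = cong (2 +_) (sum-replicate-1 j)

spike-composition : ∀ i g j → IsComposition (replicate i 1 ++ spike g j)
spike-composition i g j = All.++⁺ (replicate-1-composition i)
  (All.++⁺ (replicate-1-composition g) (s≤s z≤n ∷ replicate-1-composition j))

spike-⋢ : ∀ {β} α₀ a g j → (replicate (length α₀) 1 ++ spike g j) ⊑ (α₀ ++ replicate a 1 ++ 1 ∷ β) →
          length β ≤ j → ⊥
spike-⋢ {β} α₀ a g j s β≤j
  with ⊑-window {b = 2} {V = replicate j 1} (replicate g 1) (replicate a 1)
         (⊑-++-cancelˡ {U₁ = replicate (length α₀) 1} α₀ s
            (≤-reflexive (sym (length-replicate (length α₀)))))
         (All.replicate⁺ a ≤-refl) ≤-refl (subst (length β ≤_) (sym (length-replicate j)) β≤j)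
... | s≤s ()

-- run j x counts the entries < 2 of x between its j-th and (j+1)-th entries ≥ 2, counting from 0.
run : ℕ → List ℕ → ℕ
run _       []                 = 0
run zero    (suc (suc _) ∷ _)  = 0
run zero    (_ ∷ xs)           = suc (run zero xs)
run (suc j) (suc (suc _) ∷ xs) = run j xs
run (suc j) (_ ∷ xs)           = run (suc j) xs

run-∷-1 : ∀ j xs → run j xs ≤ run j (1 ∷ xs)
run-∷-1 zero    xs = n≤1+n _
run-∷-1 (suc j) xs = ≤-refl

run-replicate : ∀ a xs → run 0 (replicate a 1 ++ xs) ≡ a + run 0 xs
run-replicate zero    xs = refl
run-replicate (suc a) xs = cong suc (run-replicate a xs)

-- With equally many big entries on both sides, an embedding matches big entries to big
-- entries, so no run can grow.
run-mono : ∀ j {v y} → IsComposition v → IsComposition y → v ⊑ y →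
           length (bigs v) ≡ length (bigs y) → run j v ≤ run j y
run-mono j [] [] [] _ = z≤n
run-mono j {y = suc zero ∷ ys} cv (_ ∷ cy) (_ ∷ʳ v⊑y) eq =
  ≤-trans (run-mono j cv cy v⊑y eq) (run-∷-1 j ys)
run-mono j {y = suc (suc _) ∷ _} cv (_ ∷ cy) (_ ∷ʳ v⊑y) eq = ⊥-elim (⊑⇒bigs-length-≢suc v⊑y eq)
run-mono zero    {suc zero ∷ _} {suc zero ∷ _} (_ ∷ cv) (_ ∷ cy) (_ ∷ v⊑y) eq =
  s≤s (run-mono zero cv cy v⊑y eq)
run-mono (suc j) {suc zero ∷ _} {suc zero ∷ _} (_ ∷ cv) (_ ∷ cy) (_ ∷ v⊑y) eq =
  run-mono (suc j) cv cy v⊑y eq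
run-mono j {suc zero ∷ _} {suc (suc _) ∷ _} _ _ (_ ∷ v⊑y) eq = ⊥-elim (⊑⇒bigs-length-≢suc v⊑y eq)
run-mono j {suc (suc _) ∷ _} {suc zero ∷ _} _ _ (s≤s () ∷ _) _
run-mono zero    {suc (suc _) ∷ _} {suc (suc _) ∷ _} _ _ _ _ = z≤n
run-mono (suc j) {suc (suc _) ∷ _} {suc (suc _) ∷ _} (_ ∷ cv) (_ ∷ cy) (_ ∷ v⊑y) eq =
  run-mono j cv cy v⊑y (suc-injective eq)

run-++-≥ : ∀ {p} → IsComposition p → ∀ z → run 0 z ≤ run (length (bigs p)) (p ++ z)
run-++-≥ [] z = ≤-refl
run-++-≥ {suc zero ∷ p}    (_ ∷ cp) z = ≤-trans (run-++-≥ cp z) (run-∷-1 _ (p ++ z))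
run-++-≥ {suc (suc _) ∷ p} (_ ∷ cp) z = run-++-≥ cp z

run-skip : ∀ p i z → run (suc (length (bigs p) + i)) (p ++ z) ≡ run (suc i) z
run-skip []                i z = refl
run-skip (zero ∷ p)        i z = run-skip p i z
run-skip (suc zero ∷ p)    i z = run-skip p i z
run-skip (suc (suc _) ∷ p) i z = run-skip p i z

data EndsBig : List ℕ → Set where
  []   : EndsBig []
  snoc : ∀ p {b} → 2 ≤ b → EndsBig (p ++ [ b ])

run-after-EndsBig : ∀ {p} → EndsBig p → ∀ z → run (length (bigs p)) (p ++ z) ≡ run 0 z
run-after-EndsBig [] z = refl
run-after-EndsBig (snoc p {b} (s≤s (s≤s _))) z = begin
  run (length (bigs (p ++ [ b ]))) ((p ++ [ b ]) ++ z) ≡⟨ cong₂ run length-bigs (++-assoc p [ b ] z) ⟩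
  run (suc (length (bigs p) + 0)) (p ++ b ∷ z)          ≡⟨ run-skip p 0 (b ∷ z) ⟩
  run 0 z                                               ∎
  where
  open ≡-Reasoning
  length-bigs : length (bigs (p ++ [ b ])) ≡ suc (length (bigs p) + 0)
  length-bigs = begin
    length (bigs (p ++ [ b ])) ≡⟨ cong length (bigs-++ p [ b ]) ⟩
    length (bigs p ++ [ b ])   ≡⟨ length-++ (bigs p) ⟩
    length (bigs p) + 1        ≡⟨ +-comm (length (bigs p)) 1 ⟩
    suc (length (bigs p))      ≡⟨ cong suc (+-identityʳ _) ⟨
    suc (length (bigs p) + 0)  ∎

-- The first difference

-- replicate a 1 is the run of ones just before the first position where x and y differ.
data Diverge : List ℕ → List ℕ → Set where
  diverge : ∀ {α₀} a β γ {c} → EndsBig α₀ → 2 ≤ c →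
            Diverge (α₀ ++ replicate a 1 ++ 1 ∷ β) (α₀ ++ replicate a 1 ++ c ∷ γ)

Diverge-∷ : ∀ {b x y} → 1 ≤ b → Diverge x y → Diverge (b ∷ x) (b ∷ y)
Diverge-∷ {suc zero}    _ (diverge a β γ [] 2≤c) = diverge (suc a) β γ [] 2≤c
Diverge-∷ {suc (suc b)} _ (diverge a β γ [] 2≤c) =
  diverge {[ suc (suc b) ]} a β γ (snoc [] (s≤s (s≤s z≤n))) 2≤c
Diverge-∷ {b} _ (diverge a β γ (snoc p 2≤d) 2≤c) = diverge a β γ (snoc (b ∷ p) 2≤d) 2≤c

first-difference : ∀ {x y} → IsComposition x → IsComposition y → length x ≡ length y →
                   bigs x ≡ bigs y → x ≡ y ⊎ Diverge x y ⊎ Diverge y x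
first-difference [] [] _ _ = inj₁ refl
first-difference {zero ∷ _} (() ∷ _) _ _ _
first-difference {y = zero ∷ _} _ (() ∷ _) _ _
first-difference {suc zero ∷ x} {suc zero ∷ y} (1≤1 ∷ cx) (_ ∷ cy) len eq =
  Sum.map (cong (1 ∷_)) (Sum.map (Diverge-∷ 1≤1) (Diverge-∷ 1≤1))
    (first-difference cx cy (suc-injective len) eq)
first-difference {suc zero ∷ x} {suc (suc c) ∷ y} _ _ _ _ =
  inj₂ (inj₁ (diverge {[]} 0 x y [] (s≤s (s≤s z≤n))))
first-difference {suc (suc c) ∷ x} {suc zero ∷ y} _ _ _ _ =
  inj₂ (inj₂ (diverge {[]} 0 y x [] (s≤s (s≤s z≤n))))
first-difference {suc (suc b) ∷ x} {suc (suc c) ∷ y} (1≤b ∷ cx) (_ ∷ cy) len eq with ∷-injective eq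
... | refl , eq′ =
  Sum.map (cong (suc (suc b) ∷_)) (Sum.map (Diverge-∷ 1≤b) (Diverge-∷ 1≤b))
    (first-difference cx cy (suc-injective len) eq′)

composition-parts : ∀ P a {c γ} → IsComposition (P ++ replicate a 1 ++ c ∷ γ) →
                    IsComposition P × IsComposition γ
composition-parts P a cy with All.++⁻ʳ (replicate a 1) (All.++⁻ʳ P cy)
... | _ ∷ cγ = All.++⁻ˡ P cy , cγ

length-++-replicate : ∀ P a Q → length (P ++ replicate a 1 ++ Q) ≡ length P + (a + length Q)
length-++-replicate P a Q = trans (length-++ P) (cong (length P +_)
  (trans (length-++ (replicate a 1)) (cong (_+ length Q) (length-replicate a))))

-- Lowering y by k above the floor 1…1 2 1…1 keeps its length, so the result can embed into x
-- only entrywise, which puts the 2 over the 1 of x.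
big-excess-impossible : ∀ {k c} α₀ a β γ → 2 ≤ c → IsComposition (α₀ ++ replicate a 1 ++ c ∷ γ) →
  length β ≤ length γ → k < excess (α₀ ++ replicate a 1 ++ c ∷ γ) →
  DelK k (α₀ ++ replicate a 1 ++ c ∷ γ) ⊆ DelK k (α₀ ++ replicate a 1 ++ 1 ∷ β) → ⊥
big-excess-impossible {k} {c} α₀ a β γ 2≤c cy β≤γ k<E y⊆x
  with lowering-DelK (spike-composition (length α₀) a (length γ)) cy lo≤y room
  where
  y = α₀ ++ replicate a 1 ++ c ∷ γ
  lo = replicate (length α₀) 1 ++ spike a (length γ)
  cα₀ = proj₁ (composition-parts α₀ a cy)
  cγ  = proj₂ (composition-parts α₀ a cy)
  lo≤y : Pointwise _≤_ lo y
  lo≤y = Pointwise.++⁺ (replicate-1-≤ cα₀)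
           (Pointwise.++⁺ (Pointwise.refl ≤-refl {replicate a 1}) (2≤c ∷ replicate-1-≤ cγ))
  shift : ∀ k A a G → k + (A + (a + (2 + G))) ≡ suc k + (A + (a + suc G))
  shift = solve-∀
  room : k + sum lo ≤ sum y
  room = begin
    k + sum lo                                 ≡⟨ cong (k +_) (sum-spike (length α₀) a (length γ)) ⟩
    k + (length α₀ + (a + (2 + length γ)))     ≡⟨ shift k (length α₀) a (length γ) ⟩
    suc k + (length α₀ + (a + suc (length γ))) ≡⟨ cong (suc k +_) (length-++-replicate α₀ a (c ∷ γ)) ⟨
    suc k + length y                           ≤⟨ +-monoˡ-≤ (length y) k<E ⟩
    excess y + length y                        ≡⟨ +-comm (excess y) (length y) ⟩
    length y + excess y                        ≡⟨ length+excess cy ⟩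
    sum y                                      ∎
    where open ≤-Reasoning
... | u , lo≤u , _ , u∈y =
  spike-⋢ α₀ a a (length γ) (⊑-trans (Sublist.fromPointwise lo≤u) (DelK⇒⊑ (y⊆x u∈y))) β≤γ

-- The 2 of the k-deletion 1…1 2 1…1 of y has to land inside the run of ones of x.
long-run-impossible : ∀ {k c} α₀ a β γ → 2 ≤ c → IsComposition (α₀ ++ replicate a 1 ++ c ∷ γ) →
  length β ≤ length γ → excess (α₀ ++ replicate a 1 ++ c ∷ γ) ≤ k →
  k < excess (α₀ ++ replicate a 1 ++ c ∷ γ) + a →
  DelK k (α₀ ++ replicate a 1 ++ c ∷ γ) ⊆ DelK k (α₀ ++ replicate a 1 ++ 1 ∷ β) → ⊥
long-run-impossible {c = c} α₀ a β γ 2≤c cy β≤γ E≤k k<E+a y⊆x with m≤n⇒∃[o]m+o≡n E≤k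
... | e , refl with m≤n⇒∃[o]m+o≡n (+-cancelˡ-< (excess (α₀ ++ replicate a 1 ++ c ∷ γ)) e a k<E+a)
... | g , refl = spike-⋢ α₀ (suc e + g) g (length γ) (DelK⇒⊑ (y⊆x u∈y)) β≤γ
  where
  y = α₀ ++ replicate (suc e + g) 1 ++ c ∷ γ
  u = replicate (length α₀) 1 ++ spike g (length γ)
  cα₀ = proj₁ (composition-parts α₀ (suc e + g) cy)
  cγ  = proj₂ (composition-parts α₀ (suc e + g) cy)
  u⊑y : u ⊑ y
  u⊑y = Sublist.++⁺ (replicate-1-⊑ {length α₀} cα₀ ≤-refl)
          (Sublist.++⁺ (replicate-1-⊑ {g} (replicate-1-composition (suc e + g))
                          (subst (g ≤_) (sym (length-replicate (suc e + g))) (m≤n+m g (suc e))))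
                       (2≤c ∷ replicate-1-⊑ {length γ} cγ ≤-refl))
  shuffle : ∀ A g G E e → A + (g + (2 + G)) + (E + e) ≡ A + (suc e + g + suc G) + E
  shuffle = solve-∀
  sum-u : sum u + (excess y + e) ≡ sum y
  sum-u = begin
    sum u + (excess y + e)
      ≡⟨ cong (_+ (excess y + e)) (sum-spike (length α₀) g (length γ)) ⟩
    length α₀ + (g + (2 + length γ)) + (excess y + e)
      ≡⟨ shuffle (length α₀) g (length γ) (excess y) e ⟩
    length α₀ + (suc e + g + suc (length γ)) + excess y
      ≡⟨ cong (_+ excess y) (length-++-replicate α₀ (suc e + g) (c ∷ γ)) ⟨
    length y + excess y
      ≡⟨ length+excess cy ⟩
    sum y ∎
    where open ≡-Reasoning
  u∈y : DelK (excess y + e) y u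
  u∈y = ⊑⇒DelK (spike-composition (length α₀) g (length γ)) cy u⊑y sum-u

split-≤-+ : ∀ {k} A B → k ≤ A + B → ∃[ j₁ ] ∃[ j₂ ] j₁ ≤ A × j₂ ≤ B × j₁ + j₂ ≡ k
split-≤-+ {k} A B k≤A+B with k ≤? A
... | yes k≤A = k , 0 , k≤A , z≤n , +-identityʳ k
... | no  k≰A = A , k ∸ A , ≤-refl , m≤n+o⇒m∸n≤o k A k≤A+B , m+[n∸m]≡n (<⇒≤ (≰⇒> k≰A))

ones-around-run-arith : ∀ m E k a A B → 2 * m ≤ m + E + (A + (a + suc B)) → 3 * k + 1 ≤ m + E →
                        E + a ≤ k → k ≤ A + B
ones-around-run-arith m E k a A B counted 3k<n E+a≤k = +-cancelˡ-≤ (k + k + 1) k (A + B) (begin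
  k + k + 1 + k               ≡⟨ lhs k ⟩
  3 * k + 1                   ≤⟨ 3k<n ⟩
  m + E                       ≤⟨ +-monoˡ-≤ E m≤ET ⟩
  E + (A + (a + suc B)) + E   ≡⟨ rhs E A a B ⟩
  E + a + E + 1 + (A + B)     ≤⟨ +-monoˡ-≤ (A + B) (+-monoˡ-≤ 1 (+-mono-≤ E+a≤k E≤k)) ⟩
  k + k + 1 + (A + B)         ∎)
  where
  open ≤-Reasoning
  E≤k : E ≤ k
  E≤k = ≤-trans (m≤m+n E a) E+a≤k
  lhs : ∀ k → k + k + 1 + k ≡ 3 * k + 1
  lhs = solve-∀
  rhs : ∀ E A a B → E + (A + (a + suc B)) + E ≡ E + a + E + 1 + (A + B)
  rhs = solve-∀
  m≤ET : m ≤ E + (A + (a + suc B))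
  m≤ET = +-cancelˡ-≤ m m _ (begin
    m + m                       ≡⟨ cong (m +_) (+-identityʳ m) ⟨
    2 * m                       ≤⟨ counted ⟩
    m + E + (A + (a + suc B))   ≡⟨ +-assoc m E _ ⟩
    m + (E + (A + (a + suc B))) ∎)

ones-around-run-impossible : ∀ {k c} α₀ a β γ → EndsBig α₀ → 2 ≤ c →
  IsComposition (α₀ ++ replicate a 1 ++ 1 ∷ β) → IsComposition (α₀ ++ replicate a 1 ++ c ∷ γ) →
  k ≤ ones α₀ + ones β →
  length (bigs (α₀ ++ replicate a 1 ++ 1 ∷ β)) ≡ length (bigs (α₀ ++ replicate a 1 ++ c ∷ γ)) →
  DelK k (α₀ ++ replicate a 1 ++ 1 ∷ β) ⊆ DelK k (α₀ ++ replicate a 1 ++ c ∷ γ) → ⊥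
ones-around-run-impossible {c = c} α₀ a β γ ends (s≤s (s≤s _)) cx cy k≤ bigs≡ x⊆y
  with split-≤-+ (ones α₀) (ones β) k≤
... | j₁ , j₂ , j₁≤ , j₂≤ , refl = 1+n≰n run-grows
  where
  R = replicate a 1
  P = removeOnes j₁ α₀
  Q = removeOnes j₂ β
  v = P ++ R ++ 1 ∷ Q
  y = α₀ ++ R ++ c ∷ γ
  v∈x : DelK (j₁ + j₂) (α₀ ++ R ++ 1 ∷ β) v
  v∈x = DelK-trans (DelK-++ʳ (R ++ 1 ∷ β) (removeOnes-DelK j₁ α₀ j₁≤))
                   (DelK-++ˡ P (DelK-++ˡ R (DelK-∷ 1 (removeOnes-DelK j₂ β j₂≤))))
  cv : IsComposition v
  cv = DelK-composition cx v∈x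
  bigs-v : bigs v ≡ bigs (α₀ ++ R ++ 1 ∷ β)
  bigs-v = begin
    bigs (P ++ R ++ 1 ∷ Q)        ≡⟨ bigs-++ P _ ⟩
    bigs P ++ bigs (R ++ 1 ∷ Q)   ≡⟨ cong (bigs P ++_) (bigs-++ R _) ⟩
    bigs P ++ bigs R ++ bigs Q    ≡⟨ cong₂ (λ p q → p ++ bigs R ++ q)
                                             (bigs-removeOnes j₁ α₀) (bigs-removeOnes j₂ β) ⟩
    bigs α₀ ++ bigs R ++ bigs β   ≡⟨ cong (bigs α₀ ++_) (bigs-++ R _) ⟨
    bigs α₀ ++ bigs (R ++ 1 ∷ β)  ≡⟨ bigs-++ α₀ _ ⟨
    bigs (α₀ ++ R ++ 1 ∷ β)       ∎
    where open ≡-Reasoning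
  run-grows : suc a ≤ a
  run-grows = begin
    suc a                       ≤⟨ m≤m+n (suc a) (run 0 Q) ⟩
    suc a + run 0 Q             ≡⟨ +-suc a (run 0 Q) ⟨
    a + suc (run 0 Q)           ≡⟨ run-replicate a (1 ∷ Q) ⟨
    run 0 (R ++ 1 ∷ Q)          ≤⟨ run-++-≥ (All.++⁻ˡ P cv) (R ++ 1 ∷ Q) ⟩
    run (length (bigs P)) v     ≡⟨ cong (λ bs → run (length bs) v) (bigs-removeOnes j₁ α₀) ⟩
    run (length (bigs α₀)) v    ≤⟨ run-mono _ cv cy (DelK⇒⊑ (x⊆y v∈x)) (trans (cong length bigs-v) bigs≡) ⟩
    run (length (bigs α₀)) y    ≡⟨ run-after-EndsBig ends (R ++ c ∷ γ) ⟩
    run 0 (R ++ c ∷ γ)          ≡⟨ run-replicate a (c ∷ γ) ⟩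
    a + 0                       ≡⟨ +-identityʳ a ⟩
    a                           ∎
    where open ≤-Reasoning

Diverge-impossible : ∀ {k x y} → IsComposition x → IsComposition y → 3 * k + 1 ≤ sum x →
  sum x ≡ sum y → length x ≡ length y → length (bigs x) ≡ length (bigs y) →
  DelK k x ⊆ DelK k y → DelK k y ⊆ DelK k x → Diverge x y → ⊥
Diverge-impossible {k} cx cy 3k<n sum≡ len≡ bigs≡ x⊆y y⊆x (diverge {α₀} a β γ {c} ends 2≤c) =
  by-excess (k <? excess y) (k <? excess y + a)
  where
  x = α₀ ++ replicate a 1 ++ 1 ∷ β
  y = α₀ ++ replicate a 1 ++ c ∷ γ
  β≤γ : length β ≤ length γ
  β≤γ = ≤-reflexive (suc-injective (+-cancelˡ-≡ a _ _ (+-cancelˡ-≡ (length α₀) _ _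
          (trans (sym (length-++-replicate α₀ a (1 ∷ β)))
                 (trans len≡ (length-++-replicate α₀ a (c ∷ γ)))))))
  ones-x : ones x ≡ ones α₀ + (a + suc (ones β))
  ones-x = trans (ones-++ α₀ _) (cong (ones α₀ +_)
             (trans (ones-++ (replicate a 1) (1 ∷ β)) (cong (_+ suc (ones β)) (ones-replicate-1 a))))
  enough-ones : excess y + a ≤ k → k ≤ ones α₀ + ones β
  enough-ones E+a≤k = ones-around-run-arith (length x) (excess x) k a (ones α₀) (ones β)
    (subst₂ (λ s o → 2 * length x ≤ s + o) (sym (length+excess cx)) ones-x (counting-[] cx))
    (subst (3 * k + 1 ≤_) (sym (length+excess cx)) 3k<n)
    (subst (λ E → E + a ≤ k) (cong₂ _∸_ (sym sum≡) (sym len≡)) E+a≤k)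
  by-excess : Dec (k < excess y) → Dec (k < excess y + a) → ⊥
  by-excess (yes k<E) _           = big-excess-impossible α₀ a β γ 2≤c cy β≤γ k<E y⊆x
  by-excess (no  k≮E) (yes k<E+a) = long-run-impossible α₀ a β γ 2≤c cy β≤γ (≮⇒≥ k≮E) k<E+a y⊆x
  by-excess (no  _)   (no k≮E+a)  =
    ones-around-run-impossible α₀ a β γ ends 2≤c cx cy (enough-ones (≮⇒≥ k≮E+a)) bigs≡ x⊆y

lemma5 : (k n : ℕ) → 3 * k + 1 ≤ n →
         (w : List ℕ) → IsComposition w → sum w ≡ n → k < ones w →
         (w' : List ℕ) → IsComposition w' →
         (∀ u → (DelK k w u → DelK k w' u) × (DelK k w' u → DelK k w u)) →
         w' ≡ w
lemma5 k n 3k<n w cw sw k<ones w′ cw′ same =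
  Sum.[ sym , Sum.[ ⊥-elim ∘ Diverge-impossible cw cw′ 3k<sum sum≡ len≡ (cong length bigs≡) w⊆w′ w′⊆w
              , ⊥-elim ∘ Diverge-impossible cw′ cw (subst (3 * k + 1 ≤_) sum≡ 3k<sum)
                  (sym sum≡) (sym len≡) (cong length (sym bigs≡)) w′⊆w w⊆w′ ]′ ]′
    (first-difference cw cw′ len≡ bigs≡)
  where
  w⊆w′ : DelK k w ⊆ DelK k w′
  w⊆w′ = proj₁ (same _)
  w′⊆w : DelK k w′ ⊆ DelK k w
  w′⊆w = proj₂ (same _)
  k≤ones : k ≤ ones w
  k≤ones = <⇒≤ k<ones
  3k<sum : 3 * k + 1 ≤ sum w
  3k<sum = subst (3 * k + 1 ≤_) (sym sw) 3k<n
  sum≡ : sum w ≡ sum w′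
  sum≡ = sym (⊆⇒sum-≡ k≤ones w⊆w′)
  k≤ones′ : k ≤ ones w′
  k≤ones′ = ones-bound cw cw′ 3k<sum k≤ones w⊆w′
  len≡ : length w ≡ length w′
  len≡ = ≤-antisym (⊆⇒length-≤ k≤ones′ w′⊆w) (⊆⇒length-≤ k≤ones w⊆w′)
  bigs≡ : bigs w ≡ bigs w′
  bigs≡ = Pointwise-≡⇒≡ (⊑-antisym (⊆⇒bigs-⊑ k≤ones w⊆w′) (⊆⇒bigs-⊑ k≤ones′ w′⊆w))
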